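{- Let $\mathcal{C}=\{c_1,\ldots,c_m\}$ be a collection of cliques with graph union $U$ on vertex set $V$, and let $\Gamma_J,\gamma_J$ and supports be as in the context. Let $H\subseteq V$ induce a clique in $U$. Then $H$ is a maximal clique of $U$ if and only if, for every $J\subseteq\{1,\ldots,m\}$: (1) if $J\in S(H)$ then $|\Gamma_J\cap H|=\gamma_J$; and (2) if $J\notin S(H)$ then either $\Gamma_J=\emptyset$, or $\Gamma_J\neq\emptyset$ and $\{J\}\cup S(H)$ is not an intersecting family.
   Context: A clique is identified with its vertex set. For a collection $\mathcal{C}=\{c_1,\ldots,c_m\}$ of cliques of a graph, the graph union $U$ has vertex set $V=\bigcup_{j=1}^m c_j$, and distinct $u,v\in V$ are adjacent iff $u,v\in c_j$ for some $j$. For $J\subseteq\{1,\ldots,m\}$, $\Gamma_J$ is the set of $v\in V$ with $\{j:v\in c_j\}=J$, and $\gamma_J=|\Gamma_J|$. The support of $H\subseteq V$ is $S(H)=\{J\subseteq\{1,\ldots,m\}: H\cap\Gamma_J\neq\emptyset\}$. A family $\mathcal{F}$ of subsets of $\{1,\ldots,m\}$ is intersecting if any two distinct members have nonempty intersection. -}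

module Defs where

open import Data.Nat using (ℕ)
open import Data.Bool using (Bool; _∧_)
open import Data.Fin using (Fin)
open import Data.Fin.Subset using (Subset; _∈_; _∉_; _⊆_; _∩_; _∪_; ⋃; Nonempty; Empty; ∣_∣)
open import Data.Fin.Subset.Properties using (_∈?_)
open import Data.Vec using (tabulate; toList)
open import Data.Vec.Properties using (≡-dec)
import Data.Bool.Properties as BoolP
open import Data.Product using (_×_; ∃)
open import Data.Sum using (_⊎_)
open import Relation.Nullary using (¬_; does)
open import Relation.Binary.PropositionalEquality using (_≡_; _≢_)

-- A collection of m cliques c_0 … c_{m-1}, each a set of vertices drawn from a
-- finite ambient vertex type Fin n.
Collection : ℕ → ℕ → Set
Collection m n = Fin m → Subset n

module _ {m n : ℕ} (c : Collection m n) where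

  V : Subset n
  V = ⋃ (toList (tabulate c))

  Adj : Fin n → Fin n → Set
  Adj u v = u ≢ v × ∃ λ j → u ∈ c j × v ∈ c j

  IsClique : Subset n → Set
  IsClique H = H ⊆ V × (∀ u v → u ∈ H → v ∈ H → u ≢ v → Adj u v)

  IsMaximalClique : Subset n → Set
  IsMaximalClique H = IsClique H × (∀ H' → IsClique H' → H ⊆ H' → H' ⊆ H)

  profile : Fin n → Subset m
  profile v = tabulate λ j → does (v ∈? c j)

  Γ : Subset m → Subset n
  Γ J = tabulate λ v → does (v ∈? V) ∧ does (≡-dec BoolP._≟_ (profile v) J)

  γ : Subset m → ℕ
  γ J = ∣ Γ J ∣

  InSupport : Subset n → Subset m → Set
  InSupport H J = Nonempty (H ∩ Γ J)

Intersecting : {m : ℕ} → (Subset m → Set) → Set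
Intersecting F = ∀ A B → F A → F B → A ≢ B → Nonempty (A ∩ B)

{-# OPTIONS --safe #-}
module Submission where

-- Two vertices share a clique exactly when their profiles {j : v ∈ c_j} meet,
-- and vertices with equal profiles, i.e. the vertices of one block Γ_J, are
-- adjacent to the same vertices. Hence a vertex v ∈ Γ_J outside a clique H can
-- be added to H exactly when J meets the profile of every vertex of H: when
-- J ∈ S(H) this always holds (a twin of v lies in H), and when J ∉ S(H) it is
-- the statement that {J} ∪ S(H) is intersecting. Condition (1) just says
-- Γ_J ⊆ H, so (1) and (2) together say that no vertex can be added to H.

open import Defs
open import Data.Nat using (ℕ; zero; suc)
import Data.Nat.Properties as ℕ
open import Data.Bool using (Bool; T)
import Data.Bool.Properties as Bool
open import Data.Bool.Properties using (T-≡; T-∧)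
open import Data.Fin as Fin using (Fin)
open import Data.Fin.Subset using (Subset; _∈_; _∉_; _⊆_; _∩_; _∪_; ⁅_⁆; Nonempty; Empty; ∣_∣)
open import Data.Fin.Subset.Properties
  using (_∈?_; nonempty?; x∈p∩q⁺; x∈p∩q⁻; x∈p∪q⁻; p⊆p∪q; q⊆p∪q; ∉⊥; x∈⁅x⁆; x∈⁅y⁆⇒x≡y;
         p∩q⊆p; p⊆q⇒∣p∣≤∣q∣; p⊂q⇒∣p∣<∣q∣)
open import Data.Vec using (tabulate)
open import Data.Vec.Properties using (≡-dec; []=⇒lookup; lookup⇒[]=; lookup∘tabulate)
open import Data.Product using (_×_; _,_; proj₁; proj₂; ∃)
open import Data.Sum using (_⊎_; inj₁; inj₂)
open import Data.Empty using (⊥-elim)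
open import Function.Bundles using (_⇔_; mk⇔; Equivalence)
open import Relation.Nullary using (¬_; Dec; does; yes; no)
open import Relation.Binary.Definitions using (DecidableEquality)
open import Relation.Binary.PropositionalEquality using (_≡_; _≢_; refl; sym; trans; subst; subst₂)

private
  variable
    m n : ℕ

T-does⁻ : ∀ {A : Set} (a? : Dec A) → T (does a?) → A
T-does⁻ (yes a) _ = a

T-does⁺ : ∀ {A : Set} (a? : Dec A) → A → T (does a?)
T-does⁺ (yes _) _  = _
T-does⁺ (no ¬a) a = ¬a a

∈-tabulate⁻ : ∀ (f : Fin n → Bool) {i} → i ∈ tabulate f → T (f i)
∈-tabulate⁻ f {i} i∈ = Equivalence.from T-≡ (trans (sym (lookup∘tabulate f i)) ([]=⇒lookup i∈))

∈-tabulate⁺ : ∀ (f : Fin n → Bool) {i} → T (f i) → i ∈ tabulate f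
∈-tabulate⁺ f {i} fi = lookup⇒[]= i (tabulate f) (trans (lookup∘tabulate f i) (Equivalence.to T-≡ fi))

∣p∩q∣≡∣p∣⇒p⊆q : ∀ {p q : Subset n} → ∣ p ∩ q ∣ ≡ ∣ p ∣ → p ⊆ q
∣p∩q∣≡∣p∣⇒p⊆q {p = p} {q} eq {x} x∈p with x ∈? q
... | yes x∈q = x∈q
... | no x∉q = ⊥-elim (ℕ.<-irrefl eq (p⊂q⇒∣p∣<∣q∣ (p∩q⊆p p q , x , x∈p , x∉p∩q)))
  where
  x∉p∩q : x ∉ p ∩ q
  x∉p∩q x∈p∩q = x∉q (proj₂ (x∈p∩q⁻ p q x∈p∩q))

p⊆q⇒∣p∩q∣≡∣p∣ : ∀ {p q : Subset n} → p ⊆ q → ∣ p ∩ q ∣ ≡ ∣ p ∣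
p⊆q⇒∣p∩q∣≡∣p∣ {p = p} {q} p⊆q =
  ℕ.≤-antisym (p⊆q⇒∣p∣≤∣q∣ (p∩q⊆p p q)) (p⊆q⇒∣p∣≤∣q∣ λ x∈p → x∈p∩q⁺ (x∈p , p⊆q x∈p))

∈-V⁻ : ∀ (c : Collection m n) {u} → u ∈ V c → ∃ λ j → u ∈ c j
∈-V⁻ {zero}  c u∈ = ⊥-elim (∉⊥ u∈)
∈-V⁻ {suc m} c u∈ with x∈p∪q⁻ (c Fin.zero) _ u∈
... | inj₁ u∈c₀ = Fin.zero , u∈c₀
... | inj₂ u∈V′ with ∈-V⁻ (λ j → c (Fin.suc j)) u∈V′
...   | j , u∈cⱼ = Fin.suc j , u∈cⱼ

Intersecting-mono : ∀ {F G : Subset m → Set} → (∀ {K} → F K → G K) → Intersecting G → Intersecting F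
Intersecting-mono F⊆G G-int A B A∈F B∈F = G-int A B (F⊆G A∈F) (F⊆G B∈F)

empty⊎nonempty× : ∀ {B : Set} (p : Subset n) → (Nonempty p → B) → Empty p ⊎ (Nonempty p × B)
empty⊎nonempty× p f with nonempty? p
... | yes ne = inj₂ (ne , f ne)
... | no ¬ne = inj₁ ¬ne

extendedSupport : (c : Collection m n) → Subset n → Subset m → Subset m → Set
extendedSupport c H J K = K ≡ J ⊎ InSupport c H K

module _ (c : Collection m n) where

  private
    _≟_ : DecidableEquality (Subset m)
    _≟_ = ≡-dec Bool._≟_

  ShareClique : Fin n → Fin n → Set
  ShareClique u w = ∃ λ j → u ∈ c j × w ∈ c j

  ∈-profile⁻ : ∀ {u j} → j ∈ profile c u → u ∈ c j
  ∈-profile⁻ {u} {j} j∈ = T-does⁻ (u ∈? c j) (∈-tabulate⁻ _ j∈)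

  ∈-profile⁺ : ∀ {u j} → u ∈ c j → j ∈ profile c u
  ∈-profile⁺ {u} {j} u∈ = ∈-tabulate⁺ _ (T-does⁺ (u ∈? c j) u∈)

  ∈-Γ⁻ : ∀ {J u} → u ∈ Γ c J → u ∈ V c × profile c u ≡ J
  ∈-Γ⁻ {J} {u} u∈ with Equivalence.to T-∧ (∈-tabulate⁻ _ u∈)
  ... | u∈V , prof≡ = T-does⁻ (u ∈? V c) u∈V , T-does⁻ (profile c u ≟ J) prof≡

  ∈-Γ-profile : ∀ {u} → u ∈ V c → u ∈ Γ c (profile c u)
  ∈-Γ-profile {u} u∈V =
    ∈-tabulate⁺ _ (Equivalence.from T-∧ (T-does⁺ (u ∈? V c) u∈V , T-does⁺ (profile c u ≟ profile c u) refl))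

  shareClique⇒profiles-meet : ∀ {u w} → ShareClique u w → Nonempty (profile c u ∩ profile c w)
  shareClique⇒profiles-meet (j , u∈ , w∈) = j , x∈p∩q⁺ (∈-profile⁺ u∈ , ∈-profile⁺ w∈)

  profiles-meet⇒shareClique : ∀ {u w} → Nonempty (profile c u ∩ profile c w) → ShareClique u w
  profiles-meet⇒shareClique {u} {w} (j , j∈) with x∈p∩q⁻ (profile c u) (profile c w) j∈
  ... | j∈u , j∈w = j , ∈-profile⁻ j∈u , ∈-profile⁻ j∈w

  shareClique-sym : ∀ {u w} → ShareClique u w → ShareClique w u
  shareClique-sym (j , u∈ , w∈) = j , w∈ , u∈

  shareClique-refl : ∀ {u} → u ∈ V c → ShareClique u u
  shareClique-refl u∈V with ∈-V⁻ c u∈V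
  ... | j , u∈ = j , u∈ , u∈

  shareClique-twin : ∀ {u u′ w} → profile c u ≡ profile c u′ → ShareClique u w → ShareClique u′ w
  shareClique-twin {w = w} eq share =
    profiles-meet⇒shareClique (subst (λ P → Nonempty (P ∩ profile c w)) eq (shareClique⇒profiles-meet share))

  clique⇒shareClique : ∀ {H u w} → IsClique c H → u ∈ H → w ∈ H → ShareClique u w
  clique⇒shareClique {u = u} {w} (H⊆V , adj) u∈ w∈ with u Fin.≟ w
  ... | yes refl = shareClique-refl (H⊆V u∈)
  ... | no u≢w = proj₂ (adj u w u∈ w∈ u≢w)

  clique-∪-⁅⁆ : ∀ {H v} → IsClique c H → v ∈ V c → (∀ {h} → h ∈ H → ShareClique v h) →
                IsClique c (H ∪ ⁅ v ⁆)
  clique-∪-⁅⁆ {H} {v} cl@(H⊆V , _) v∈V share = H∪v⊆V , λ u w u∈ w∈ u≢w → u≢w , shares u∈ w∈ u≢w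
    where
    H∪v⊆V : H ∪ ⁅ v ⁆ ⊆ V c
    H∪v⊆V u∈ with x∈p∪q⁻ H _ u∈
    ... | inj₁ u∈H = H⊆V u∈H
    ... | inj₂ u∈v rewrite x∈⁅y⁆⇒x≡y v u∈v = v∈V
    shares : ∀ {u w} → u ∈ H ∪ ⁅ v ⁆ → w ∈ H ∪ ⁅ v ⁆ → u ≢ w → ShareClique u w
    shares u∈ w∈ u≢w with x∈p∪q⁻ H _ u∈ | x∈p∪q⁻ H _ w∈
    ... | inj₁ u∈H | inj₁ w∈H = clique⇒shareClique cl u∈H w∈H
    ... | inj₁ u∈H | inj₂ w∈v rewrite x∈⁅y⁆⇒x≡y v w∈v = shareClique-sym (share u∈H)
    ... | inj₂ u∈v | inj₁ w∈H rewrite x∈⁅y⁆⇒x≡y v u∈v = share w∈H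
    ... | inj₂ u∈v | inj₂ w∈v = ⊥-elim (u≢w (trans (x∈⁅y⁆⇒x≡y v u∈v) (sym (x∈⁅y⁆⇒x≡y v w∈v))))

  maximalClique-absorbs : ∀ {H v} → IsMaximalClique c H → v ∈ V c → (∀ {h} → h ∈ H → ShareClique v h) →
                          v ∈ H
  maximalClique-absorbs {H} {v} (cl , maximal) v∈V share =
    maximal (H ∪ ⁅ v ⁆) (clique-∪-⁅⁆ cl v∈V share) (p⊆p∪q _) (q⊆p∪q H _ (x∈⁅x⁆ v))

  clique⇒support-intersecting : ∀ {H} → IsClique c H → Intersecting (InSupport c H)
  clique⇒support-intersecting {H} cl A B (a , a∈) (b , b∈) _
    with x∈p∩q⁻ H (Γ c A) a∈ | x∈p∩q⁻ H (Γ c B) b∈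
  ... | a∈H , a∈Γ | b∈H , b∈Γ =
    subst₂ (λ A B → Nonempty (A ∩ B)) (proj₂ (∈-Γ⁻ a∈Γ)) (proj₂ (∈-Γ⁻ b∈Γ))
      (shareClique⇒profiles-meet (clique⇒shareClique cl a∈H b∈H))

  maximalClique⇒block⊆ : ∀ {H J} → IsMaximalClique c H → InSupport c H J → Γ c J ⊆ H
  maximalClique⇒block⊆ {H} {J} mc@(cl , _) (w , w∈) v∈Γ with x∈p∩q⁻ H (Γ c J) w∈
  ... | w∈H , w∈Γ = maximalClique-absorbs mc (proj₁ (∈-Γ⁻ v∈Γ)) λ h∈H →
    shareClique-twin (trans (proj₂ (∈-Γ⁻ w∈Γ)) (sym (proj₂ (∈-Γ⁻ v∈Γ)))) (clique⇒shareClique cl w∈H h∈H)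

  maximalClique⇒¬intersecting : ∀ {H J} → IsMaximalClique c H → ¬ InSupport c H J → Nonempty (Γ c J) →
                                ¬ Intersecting (extendedSupport c H J)
  maximalClique⇒¬intersecting {H} {J} mc@(cl , _) J∉S (v , v∈Γ) intersecting =
    J∉S (v , x∈p∩q⁺ (maximalClique-absorbs mc (proj₁ (∈-Γ⁻ v∈Γ)) share , v∈Γ))
    where
    share : ∀ {h} → h ∈ H → ShareClique v h
    share {h} h∈H = profiles-meet⇒shareClique
      (subst (λ P → Nonempty (P ∩ profile c h)) (sym (proj₂ (∈-Γ⁻ v∈Γ)))
        (intersecting J (profile c h) (inj₁ refl) (inj₂ h∈S) J≢))
      where
      h∈S : InSupport c H (profile c h)
      h∈S = h , x∈p∩q⁺ (h∈H , ∈-Γ-profile (proj₁ cl h∈H))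
      J≢ : J ≢ profile c h
      J≢ refl = J∉S h∈S

  extendedSupport⊆support : ∀ {H H′ x K} → H ⊆ H′ → x ∈ H′ → x ∈ V c →
                            extendedSupport c H (profile c x) K → InSupport c H′ K
  extendedSupport⊆support _ x∈H′ x∈V (inj₁ refl) = _ , x∈p∩q⁺ (x∈H′ , ∈-Γ-profile x∈V)
  extendedSupport⊆support {H} {K = K} H⊆H′ _ _ (inj₂ (h , h∈)) with x∈p∩q⁻ H (Γ c K) h∈
  ... | h∈H , h∈Γ = h , x∈p∩q⁺ (H⊆H′ h∈H , h∈Γ)

  block-conditions⇒∈ : ∀ {H H′ x} → IsClique c H′ → H ⊆ H′ → x ∈ H′ →
    let J = profile c x in
    (InSupport c H J → Γ c J ⊆ H) →
    (¬ InSupport c H J → Empty (Γ c J) ⊎ (Nonempty (Γ c J) × ¬ Intersecting (extendedSupport c H J))) →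
    x ∈ H
  block-conditions⇒∈ {H} {x = x} cl′@(H′⊆V , _) H⊆H′ x∈H′ inside outside
    with nonempty? (H ∩ Γ c (profile c x))
  ... | yes J∈S = inside J∈S (∈-Γ-profile (H′⊆V x∈H′))
  ... | no J∉S with outside J∉S
  ...   | inj₁ empty = ⊥-elim (empty (x , ∈-Γ-profile (H′⊆V x∈H′)))
  ...   | inj₂ (_ , ¬intersecting) = ⊥-elim (¬intersecting
          (Intersecting-mono (extendedSupport⊆support H⊆H′ x∈H′ (H′⊆V x∈H′))
            (clique⇒support-intersecting cl′)))

theorem4p13 : {m n : ℕ} (c : Collection m n) (H : Subset n) → IsClique c H →
    (IsMaximalClique c H ⇔
      (∀ (J : Subset m) →
        (InSupport c H J → ∣ Γ c J ∩ H ∣ ≡ γ c J)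
        × (¬ InSupport c H J →
            Empty (Γ c J)
            ⊎ (Nonempty (Γ c J) × ¬ Intersecting (λ K → K ≡ J ⊎ InSupport c H K)))))
theorem4p13 c H cl = mk⇔
  (λ mc J → (λ J∈S → p⊆q⇒∣p∩q∣≡∣p∣ (maximalClique⇒block⊆ c mc J∈S))
          , (λ J∉S → empty⊎nonempty× (Γ c J) (maximalClique⇒¬intersecting c mc J∉S)))
  (λ conditions → cl , λ H′ cl′ H⊆H′ {x} x∈H′ →
    let (inside , outside) = conditions (profile c x) in
    block-conditions⇒∈ c cl′ H⊆H′ x∈H′ (λ J∈S → ∣p∩q∣≡∣p∣⇒p⊆q (inside J∈S)) outside)
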